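{- Let $x=x_1\cdots x_l$ and $y=y_1\cdots y_l$ be words in $\mathbf N$, and let $x'=(x_1+1)\cdots(x_l+1)$ and $y'=(y_1+1)\cdots(y_l+1)$. Then $u_x\equiv u_y\pmod I$ if and only if $u_{x'}\equiv u_{y'}\pmod I$.
   Context: The Schur operator $u_i$ ($i\ge1$) acts linearly on the vector space $\mathbf C[\mathbf Y]$ with basis all partitions by $u_i(\lambda)=\mu$ if the Young diagram of $\mu$ is obtained from that of $\lambda$ by adding one box in column $i$ and $\mu$ is a partition, and $u_i(\lambda)=0$ otherwise. $\mathcal U$ is the free associative $\mathbf C$-algebra on $u_1,u_2,\dots$, acting on $\mathbf C[\mathbf Y]$ via this action; for a word $x=x_1\cdots x_l$, $u_x=u_{x_1}\cdots u_{x_l}$. $I$ is the two-sided ideal of elements of $\mathcal U$ annihilating $\mathbf C[\mathbf Y]$, so $u\equiv u'\pmod I$ iff $u(\lambda)=u'(\lambda)$ for all partitions $\lambda$. -}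

module Defs where

open import Data.Nat using (ℕ; zero; suc; _≤_; _<_; _≥_; _≤?_; _≟_)
open import Data.List using (List; []; _∷_; map)
open import Data.List.Relation.Unary.All using (All)
open import Data.List.Relation.Unary.Linked using (Linked)
open import Data.Maybe using (Maybe; just; nothing; _>>=_)
open import Relation.Nullary using (yes; no)
open import Relation.Binary.PropositionalEquality using (_≡_)

-- A partition is represented by its list of row lengths (Young diagram in
-- English notation): weakly decreasing, all parts positive.
IsPartition : List ℕ → Set
IsPartition λ′ = Linked _≥_ λ′ × All (0 <_) λ′
  where open import Data.Product using (_×_)

-- addBox i λ : add one box in column i (i ≥ 1) of the diagram λ.
-- The new box lies in the first row r whose length is < i; this yields a
-- partition iff that row has length exactly i - 1 (rows beyond the parts
-- have length 0).
addBox : ℕ → List ℕ → Maybe (List ℕ)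
addBox i [] with i ≟ 1
... | yes _ = just (1 ∷ [])
... | no _  = nothing
addBox i (r ∷ rs) with i ≤? r
... | yes _ = Data.Maybe.map (r ∷_) (addBox i rs)
  where import Data.Maybe
... | no _ with suc r ≟ i
...   | yes _ = just (i ∷ rs)
...   | no _  = nothing

-- Schur operator u_i on basis elements (nothing stands for 0).
u : ℕ → Maybe (List ℕ) → Maybe (List ℕ)
u i m = m >>= addBox i

-- u_x = u_{x_1} ⋯ u_{x_l} applied to a basis element (u_{x_l} acts first).
uWord : List ℕ → Maybe (List ℕ) → Maybe (List ℕ)
uWord []      m = m
uWord (a ∷ w) m = u a (uWord w m)

-- u_x ≡ u_y (mod I): u_x(λ) = u_y(λ) for every partition λ.  Since both
-- sides map each basis vector to a basis vector or to 0, equality in C[Y]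
-- is equality of these Maybe-values.
_≡I_ : List ℕ → List ℕ → Set
x ≡I y = (λ′ : List ℕ) → IsPartition λ′ → uWord x (just λ′) ≡ uWord y (just λ′)

shift : List ℕ → List ℕ
shift = map suc

-- The proof rests on the operator φ_c ("liftColumn c") which prepends a
-- first column of height c to a diagram λ with at most c rows, and sends
-- longer diagrams to 0.  Adding a box in column i+1 of φ_c(λ) is the same
-- as adding a box in column i of λ and then prepending the column, i.e.
--     u_{i+1} ∘ φ_c = φ_c ∘ u_i        (i ≥ 1),
-- hence u_{x'} ∘ φ_c = φ_c ∘ u_x for every word x with letters ≥ 1.
--  * (⇒) every partition μ is φ_c(λ) for c = ℓ(μ) and λ the partition
--    obtained by deleting the first column of μ; so u_{x'} and u_{y'}
--    agree on μ whenever u_x and u_y agree on λ.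
--  * (⇐) for c large compared with ℓ(λ) and the word lengths, u_x(λ) and
--    u_y(λ) have at most c rows, and φ_c is injective on such partitions.
module Submission where

open import Defs
open import Data.Nat
  using (ℕ; zero; suc; pred; _+_; _∸_; _≤_; _<_; _≥_; _≤?_; _≟_; z≤n; s≤s)
open import Data.Nat.Properties
  using (≤-refl; ≤-trans; <-irrefl; <-≤-trans; ≰⇒>; n≤1+n; m≤m+n; m≤n+m; +-monoˡ-≤; m+n∸m≡n)
open import Data.List using (List; []; _∷_; length; map; _++_; replicate)
open import Data.List.Properties using (∷-injective)
open import Data.List.Relation.Unary.All using (All; []; _∷_)
open import Data.List.Relation.Unary.Linked as Linked using (Linked; []; [-]; _∷_)
open import Data.Maybe using (Maybe; just; nothing)
import Data.Maybe as Maybe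
open import Data.Maybe.Properties using (just-injective)
open import Data.Maybe.Relation.Unary.All as IfJust using (just; nothing)
open import Data.Product using (Σ-syntax; _×_; _,_; proj₁; proj₂)
open import Data.Empty using (⊥-elim)
open import Relation.Nullary using (yes; no)
open import Relation.Binary.PropositionalEquality
  using (_≡_; refl; sym; trans; cong; cong₂; module ≡-Reasoning)
open import Function.Bundles using (_⇔_; mk⇔)

Pos : List ℕ → Set
Pos = All (0 <_)

Fits : ℕ → List ℕ → Set
Fits c λ′ = length λ′ ≤ c × Pos λ′

Fits-mono : ∀ {c c′ λ′} → c ≤ c′ → Fits c λ′ → Fits c′ λ′
Fits-mono c≤c′ (ℓ , pos) = ≤-trans ℓ c≤c′ , pos

addBox-length : ∀ i λ′ →
  IfJust.All (λ μ → length λ′ ≤ length μ × length μ ≤ suc (length λ′)) (addBox i λ′)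
addBox-length i [] with i ≟ 1
... | yes _ = just (z≤n , ≤-refl)
... | no _  = nothing
addBox-length i (r ∷ rs) with i ≤? r
... | yes _ with addBox i rs | addBox-length i rs
...   | just _  | just (grow , bound) = just (s≤s grow , s≤s bound)
...   | nothing | nothing             = nothing
addBox-length i (r ∷ rs) | no _ with suc r ≟ i
...   | yes _ = just (≤-refl , n≤1+n _)
...   | no _  = nothing

addBox-positive : ∀ i λ′ → Pos λ′ → IfJust.All Pos (addBox i λ′)
addBox-positive i [] _ with i ≟ 1
... | yes _ = just (s≤s z≤n ∷ [])
... | no _  = nothing
addBox-positive i (r ∷ rs) (r>0 ∷ rs>0) with i ≤? r
... | yes _ with addBox i rs | addBox-positive i rs rs>0
...   | just _  | just pos = just (r>0 ∷ pos)
...   | nothing | nothing  = nothing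
addBox-positive i (r ∷ rs) (_ ∷ rs>0) | no _ with suc r ≟ i
...   | yes refl = just (s≤s z≤n ∷ rs>0)
...   | no _  = nothing

uWord-fits : ∀ w λ′ → Pos λ′ → IfJust.All (Fits (length w + length λ′)) (uWord w (just λ′))
uWord-fits [] λ′ pos = just (≤-refl , pos)
uWord-fits (a ∷ w) λ′ pos with uWord w (just λ′) | uWord-fits w λ′ pos
... | nothing | nothing = nothing
... | just μ  | just (ℓ , μ>0) =
  IfJust.zipWith (λ ((_ , bound) , pos′) → ≤-trans bound (s≤s ℓ) , pos′)
                 (addBox-length a μ , addBox-positive a μ μ>0)

-- widen k λ: every row grows by one box and k rows of length 1 are
-- appended, i.e. a column of height ℓ(λ) + k is prepended.
widen : ℕ → List ℕ → List ℕ
widen k λ′ = map suc λ′ ++ replicate k 1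

-- Prepend a column of height c (meaningful when ℓ(λ) ≤ c).
addColumn : ℕ → List ℕ → List ℕ
addColumn c λ′ = widen (c ∸ length λ′) λ′

liftColumn : ℕ → Maybe (List ℕ) → Maybe (List ℕ)
liftColumn c nothing = nothing
liftColumn c (just λ′) with length λ′ ≤? c
... | yes _ = just (addColumn c λ′)
... | no _  = nothing

liftColumn-fits : ∀ {c λ′} → length λ′ ≤ c → liftColumn c (just λ′) ≡ just (addColumn c λ′)
liftColumn-fits {c} {λ′} ℓ with length λ′ ≤? c
... | yes _ = refl
... | no ℓ̸ = ⊥-elim (ℓ̸ ℓ)

liftColumn-tooLong : ∀ c m → IfJust.All (λ μ → c < length μ) m → liftColumn c m ≡ nothing
liftColumn-tooLong c nothing nothing = refl
liftColumn-tooLong c (just μ) (just c<ℓ) with length μ ≤? c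
... | yes ℓ≤c = ⊥-elim (<-irrefl refl (<-≤-trans c<ℓ ℓ≤c))
... | no _    = refl

liftColumn-cons : ∀ r c m →
  Maybe.map (suc r ∷_) (liftColumn c m) ≡ liftColumn (suc c) (Maybe.map (r ∷_) m)
liftColumn-cons r c nothing = refl
liftColumn-cons r c (just λ′) with length λ′ ≤? c | suc (length λ′) ≤? suc c
... | yes _ | yes _       = refl
... | yes ℓ | no ℓ̸        = ⊥-elim (ℓ̸ (s≤s ℓ))
... | no ℓ̸  | yes (s≤s ℓ) = ⊥-elim (ℓ̸ ℓ)
... | no _  | no _        = refl

-- The core combinatorial fact: a box in column i+1 of φ_c(λ) lands in the
-- same row as a box in column i of λ (for i ≥ 1 and ℓ(λ) ≤ c).
addBox-addColumn : ∀ i c λ′ → 1 ≤ i → length λ′ ≤ c →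
  addBox (suc i) (addColumn c λ′) ≡ liftColumn c (addBox i λ′)
addBox-addColumn (suc zero)    zero    [] _ _ = refl
addBox-addColumn (suc (suc _)) zero    [] _ _ = refl
addBox-addColumn (suc zero)    (suc _) [] _ _ = refl
addBox-addColumn (suc (suc _)) (suc _) [] _ _ = refl
addBox-addColumn i (suc c) (r ∷ rs) i≥1 (s≤s ℓ) with suc i ≤? suc r | i ≤? r
... | yes _       | yes _ rewrite addBox-addColumn i c rs i≥1 ℓ = liftColumn-cons r c (addBox i rs)
... | yes (s≤s p) | no p̸  = ⊥-elim (p̸ p)
... | no p̸        | yes p = ⊥-elim (p̸ (s≤s p))
... | no _        | no _ with suc (suc r) ≟ suc i | suc r ≟ i
...   | yes _ | yes _ = sym (liftColumn-fits (s≤s ℓ))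
...   | yes p | no p̸  = ⊥-elim (p̸ (cong pred p))
...   | no p̸  | yes p = ⊥-elim (p̸ (cong suc p))
...   | no _  | no _  = refl

u-liftColumn : ∀ i c m → 1 ≤ i → u (suc i) (liftColumn c m) ≡ liftColumn c (u i m)
u-liftColumn i c nothing _ = refl
u-liftColumn i c (just λ′) i≥1 with length λ′ ≤? c
... | yes ℓ = addBox-addColumn i c λ′ i≥1 ℓ
... | no ℓ̸  = sym (liftColumn-tooLong c (addBox i λ′)
                 (IfJust.map (λ (grow , _) → <-≤-trans (≰⇒> ℓ̸) grow) (addBox-length i λ′)))

uWord-shift-liftColumn : ∀ x c m → All (1 ≤_) x →
  uWord (shift x) (liftColumn c m) ≡ liftColumn c (uWord x m)
uWord-shift-liftColumn []      c m []           = refl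
uWord-shift-liftColumn (a ∷ x) c m (a≥1 ∷ x≥1) = begin
  u (suc a) (uWord (shift x) (liftColumn c m)) ≡⟨ cong (u (suc a)) (uWord-shift-liftColumn x c m x≥1) ⟩
  u (suc a) (liftColumn c (uWord x m))         ≡⟨ u-liftColumn a c (uWord x m) a≥1 ⟩
  liftColumn c (u a (uWord x m))               ∎
  where open ≡-Reasoning

replicate-linked : ∀ k n → Linked _≥_ (replicate k n)
replicate-linked zero          n = []
replicate-linked (suc zero)    n = [-]
replicate-linked (suc (suc k)) n = ≤-refl ∷ replicate-linked (suc k) n

widen-linked : ∀ k λ′ → Linked _≥_ λ′ → Linked _≥_ (widen k λ′)
widen-linked k       []           _       = replicate-linked k 1
widen-linked zero    (r ∷ [])     _       = [-]
widen-linked (suc k) (r ∷ [])     _       = s≤s z≤n ∷ replicate-linked (suc k) 1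
widen-linked k       (r ∷ s ∷ λ′) (r≥s ∷ l) = s≤s r≥s ∷ widen-linked k (s ∷ λ′) l

widen-positive : ∀ k λ′ → Pos (widen k λ′)
widen-positive zero    []       = []
widen-positive (suc k) []       = s≤s z≤n ∷ widen-positive k []
widen-positive k       (_ ∷ rs) = s≤s z≤n ∷ widen-positive k rs

widen-partition : ∀ k λ′ → IsPartition λ′ → IsPartition (widen k λ′)
widen-partition k λ′ (linked , _) = widen-linked k λ′ linked , widen-positive k λ′

-- Rows of length ≥ 2 determine λ, and appended rows have length 1, so the
-- widened diagram determines λ when λ has positive parts.
widen-injective : ∀ {k k′} λ′ μ → widen k λ′ ≡ widen k′ μ → Pos λ′ → Pos μ → λ′ ≡ μ
widen-injective             []       []       _  _ _ = refl
widen-injective {zero}      []       (_ ∷ _)  () _ _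
widen-injective {suc _}     []       (zero ∷ _) _ _ (() ∷ _)
widen-injective {suc _}     []       (suc _ ∷ _) () _ _
widen-injective {k′ = zero} (_ ∷ _)  []       () _ _
widen-injective {k′ = suc _} (zero ∷ _) []    _ (() ∷ _) _
widen-injective {k′ = suc _} (suc _ ∷ _) []   () _ _
widen-injective (r ∷ rs) (s ∷ ss) eq (_ ∷ rs>0) (_ ∷ ss>0) =
  cong₂ _∷_ (cong pred (proj₁ (∷-injective eq)))
            (widen-injective rs ss (proj₂ (∷-injective eq)) rs>0 ss>0)

-- Every partition is obtained by prepending a column to a partition: strip
-- one box from each row; a row of length 1 forces all later rows to be 1.
partition-widen : ∀ μ → IsPartition μ → Σ[ λ′ ∈ List ℕ ] Σ[ k ∈ ℕ ] IsPartition λ′ × μ ≡ widen k λ′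
partition-widen [] _ = [] , 0 , ([] , []) , refl
partition-widen (zero ∷ rs) (_ , () ∷ _)
partition-widen (suc zero ∷ rs) (linked , _ ∷ rs>0)
  with partition-widen rs (Linked.tail linked , rs>0)
... | [] , k , _ , refl = [] , suc k , ([] , []) , refl
... | (zero  ∷ _) , _ , (_ , () ∷ _) , refl
... | (suc _ ∷ _) , _ , _ , refl with Linked.head linked
...   | s≤s ()
partition-widen (suc (suc r) ∷ rs) (linked , _ ∷ rs>0)
  with partition-widen rs (Linked.tail linked , rs>0)
... | [] , k , _ , refl = (suc r ∷ []) , k , ([-] , s≤s z≤n ∷ []) , refl
... | (s ∷ λ′) , k , (l , λ′>0) , refl with Linked.head linked
...   | s≤s r≥s = (suc r ∷ s ∷ λ′) , k , (r≥s ∷ l , s≤s z≤n ∷ λ′>0) , refl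

partition-liftColumn : ∀ μ → IsPartition μ →
  Σ[ λ′ ∈ List ℕ ] Σ[ c ∈ ℕ ] IsPartition λ′ × just μ ≡ liftColumn c (just λ′)
partition-liftColumn μ pμ with partition-widen μ pμ
... | λ′ , k , pλ , refl = λ′ , length λ′ + k , pλ , (begin
  just (widen k λ′)                              ≡⟨ cong (λ j → just (widen j λ′)) (sym (m+n∸m≡n (length λ′) k)) ⟩
  just (addColumn (length λ′ + k) λ′)            ≡⟨ sym (liftColumn-fits (m≤m+n (length λ′) k)) ⟩
  liftColumn (length λ′ + k) (just λ′)           ∎)
  where open ≡-Reasoning

liftColumn-injective : ∀ c m m′ → IfJust.All (Fits c) m → IfJust.All (Fits c) m′ →
  liftColumn c m ≡ liftColumn c m′ → m ≡ m′
liftColumn-injective c nothing nothing _ _ _ = refl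
liftColumn-injective c (just λ′) nothing (just (ℓ , _)) _ eq
  with () ← trans (sym (liftColumn-fits ℓ)) eq
liftColumn-injective c nothing (just μ) _ (just (ℓ , _)) eq
  with () ← trans eq (liftColumn-fits ℓ)
liftColumn-injective c (just λ′) (just μ) (just (ℓλ , λ>0)) (just (ℓμ , μ>0)) eq =
  cong just (widen-injective λ′ μ
    (just-injective (trans (sym (liftColumn-fits ℓλ)) (trans eq (liftColumn-fits ℓμ))))
    λ>0 μ>0)

shift-preserves : ∀ x y → All (1 ≤_) x → All (1 ≤_) y → x ≡I y → shift x ≡I shift y
shift-preserves x y x≥1 y≥1 x≡y μ pμ with partition-liftColumn μ pμ
... | λ′ , c , pλ , μ≡φλ = begin
  uWord (shift x) (just μ)                   ≡⟨ cong (uWord (shift x)) μ≡φλ ⟩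
  uWord (shift x) (liftColumn c (just λ′))   ≡⟨ uWord-shift-liftColumn x c (just λ′) x≥1 ⟩
  liftColumn c (uWord x (just λ′))           ≡⟨ cong (liftColumn c) (x≡y λ′ pλ) ⟩
  liftColumn c (uWord y (just λ′))           ≡⟨ sym (uWord-shift-liftColumn y c (just λ′) y≥1) ⟩
  uWord (shift y) (liftColumn c (just λ′))   ≡⟨ cong (uWord (shift y)) (sym μ≡φλ) ⟩
  uWord (shift y) (just μ)                   ∎
  where open ≡-Reasoning

shift-reflects : ∀ x y → All (1 ≤_) x → All (1 ≤_) y → shift x ≡I shift y → x ≡I y
shift-reflects x y x≥1 y≥1 x′≡y′ λ′ pλ@(_ , λ>0) =
  liftColumn-injective c _ _ (fits x (m≤m+n (length x) (length y)))
                             (fits y (m≤n+m (length y) (length x)))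
    (begin
      liftColumn c (uWord x (just λ′))           ≡⟨ sym (uWord-shift-liftColumn x c (just λ′) x≥1) ⟩
      uWord (shift x) (liftColumn c (just λ′))   ≡⟨ cong (uWord (shift x)) φλ ⟩
      uWord (shift x) (just (addColumn c λ′))    ≡⟨ x′≡y′ (addColumn c λ′) (widen-partition _ λ′ pλ) ⟩
      uWord (shift y) (just (addColumn c λ′))    ≡⟨ cong (uWord (shift y)) (sym φλ) ⟩
      uWord (shift y) (liftColumn c (just λ′))   ≡⟨ uWord-shift-liftColumn y c (just λ′) y≥1 ⟩
      liftColumn c (uWord y (just λ′))           ∎)
  where
  open ≡-Reasoning
  -- a column height exceeding every diagram that can occur
  c : ℕ
  c = length x + length y + length λ′
  φλ : liftColumn c (just λ′) ≡ just (addColumn c λ′)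
  φλ = liftColumn-fits (m≤n+m (length λ′) (length x + length y))
  fits : ∀ w → length w ≤ length x + length y → IfJust.All (Fits c) (uWord w (just λ′))
  fits w w≤ = IfJust.map (Fits-mono (+-monoˡ-≤ (length λ′) w≤)) (uWord-fits w λ′ λ>0)

mainTheorem6 : (x y : List ℕ) → All (1 ≤_) x → All (1 ≤_) y →
                 length x ≡ length y →
                 (x ≡I y) ⇔ (shift x ≡I shift y)
mainTheorem6 x y x≥1 y≥1 _ = mk⇔ (shift-preserves x y x≥1 y≥1) (shift-reflects x y x≥1 y≥1)
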